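{- There are constants $\alpha\in(0,1/2)$ and $c>0$ such that for every $d$, the number of balanced independent sets $I$ of $Q_d$ with $|I|\le \alpha N$ is at most $2^{(1-c)N/2}$.
   Context: $Q_d$ is the $d$-dimensional Hamming cube (vertices: binary strings of length $d$, adjacent iff they differ in exactly one coordinate), $N=2^d$. $\mathcal E,\mathcal O$ are the sets of vertices with an even, respectively odd, number of 1's. An independent set $I$ is balanced if $|I\cap \mathcal E|=|I\cap\mathcal O|$. -}

module Defs where

open import Data.Nat using (ℕ; zero; suc; _+_; _*_; _^_; _≤_; _<_; _%_)
open import Data.Bool using (Bool; true; false; if_then_else_; _∧_; not)
open import Data.Vec using (Vec; []; _∷_)
open import Data.List using (List; []; _∷_; _++_; map)
open import Data.Nat.ListAction using (sum)
open import Data.Product using (_×_; ∃-syntax)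
open import Data.Empty using (⊥)
open import Relation.Binary.PropositionalEquality using (_≡_; _≢_)

Vertex : ℕ → Set
Vertex d = Vec Bool d

VSet : ℕ → Set
VSet d = Vertex d → Bool

Distinct : ∀ {d} → VSet d → VSet d → Set
Distinct {d} I J = ∃[ v ] (I v ≢ J v)

allVertices : (d : ℕ) → List (Vertex d)
allVertices zero = [] ∷ []
allVertices (suc d) = map (false ∷_) (allVertices d) ++ map (true ∷_) (allVertices d)

b2n : Bool → ℕ
b2n true = 1
b2n false = 0

hamming : ∀ {d} → Vertex d → Vertex d → ℕ
hamming [] [] = 0
hamming (x ∷ u) (y ∷ v) = (if x Data.Bool.xor y then 1 else 0) + hamming u v

Adjacent : ∀ {d} → Vertex d → Vertex d → Set
Adjacent u v = hamming u v ≡ 1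

weight : ∀ {d} → Vertex d → ℕ
weight [] = 0
weight (x ∷ v) = b2n x + weight v

isEven : ∀ {d} → Vertex d → Bool
isEven v = Data.Nat._≡ᵇ_ (weight v % 2) 0

size : ∀ {d} → VSet d → ℕ
size {d} I = sum (map (λ v → b2n (I v)) (allVertices d))

evenPart : ∀ {d} → VSet d → ℕ
evenPart {d} I = sum (map (λ v → b2n (I v ∧ isEven v)) (allVertices d))

oddPart : ∀ {d} → VSet d → ℕ
oddPart {d} I = sum (map (λ v → b2n (I v ∧ not (isEven v))) (allVertices d))

Independent : ∀ {d} → VSet d → Set
Independent {d} I = (u v : Vertex d) → Adjacent u v → I u ≡ true → I v ≡ true → ⊥

Balanced : ∀ {d} → VSet d → Set
Balanced I = evenPart I ≡ oddPart I

-- Give a set I the weight 16^(N - |I|). Sets that differ somewhere have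
-- total weight at most 17^N, since splitting on one vertex multiplies the bound by 1 + 16,
-- while every set of size at most N/64 has weight at least 16^(63N/64). Hence there are at
-- most 17^N / 16^(63N/64) < 2^(0.17 N) such sets, which is below 2^((1 - 5/8) N / 2).
module Submission where

open import Defs
open import Data.Nat using (ℕ; zero; suc; _+_; _*_; _^_; _/_; _≤_; _<_; z≤n; s≤s; _≤?_; NonZero)
open import Data.Nat.Properties
open import Data.Nat.DivMod using (m*n/n≡m; m/n*n≤m; /-monoˡ-≤)
open import Data.Nat.ListAction using (sum)
open import Data.Bool using (Bool; true; false; not)
import Data.Bool.Properties as Bool
open import Data.Vec using ([]; _∷_)
open import Data.List using (List; []; _∷_; _++_; length; map; filter)
open import Data.List.Properties using (length-++; length-map)
open import Data.List.Membership.Propositional using (_∈_; lose)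
open import Data.List.Membership.Propositional.Properties using (∈-map⁺; ∈-++⁺ˡ; ∈-++⁺ʳ)
open import Data.List.Relation.Unary.Any using (Any; here; there)
open import Data.List.Relation.Unary.All using (All; []; _∷_)
import Data.List.Relation.Unary.All as All
open import Data.List.Relation.Unary.All.Properties using (all-filter)
open import Data.List.Relation.Unary.AllPairs using (AllPairs; []; _∷_)
import Data.List.Relation.Unary.AllPairs as AllPairs
import Data.List.Relation.Unary.AllPairs.Properties as AllPairs
open import Data.Product using (_×_; _,_; ∃-syntax)
open import Data.Empty using (⊥-elim)
open import Function using (_∘_)
open import Algebra.Properties.CommutativeSemigroup +-commutativeSemigroup using (x∙yz≈y∙xz)
open import Relation.Nullary.Decidable using (toWitness)
open import Relation.Binary.PropositionalEquality

^-distribʳ-* : ∀ m n o → (m * n) ^ o ≡ m ^ o * n ^ o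
^-distribʳ-* m n zero = refl
^-distribʳ-* m n (suc o) = begin
  (m * n) * (m * n) ^ o      ≡⟨ cong ((m * n) *_) (^-distribʳ-* m n o) ⟩
  (m * n) * (m ^ o * n ^ o)  ≡⟨ [m*n]*[o*p]≡[m*o]*[n*p] m n (m ^ o) (n ^ o) ⟩
  (m * m ^ o) * (n * n ^ o)  ∎
  where open ≡-Reasoning

[m^n]^o≡[m^o]^n : ∀ m n o → (m ^ n) ^ o ≡ (m ^ o) ^ n
[m^n]^o≡[m^o]^n m n o = begin
  (m ^ n) ^ o  ≡⟨ ^-*-assoc m n o ⟩
  m ^ (n * o)  ≡⟨ cong (m ^_) (*-comm n o) ⟩
  m ^ (o * n)  ≡⟨ ^-*-assoc m o n ⟨
  (m ^ o) ^ n  ∎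
  where open ≡-Reasoning

m*n≤o⇒n≤o/m : ∀ m n o .{{_ : NonZero m}} → m * n ≤ o → n ≤ o / m
m*n≤o⇒n≤o/m m n o m*n≤o = begin
  n          ≡⟨ m*n/n≡m n m ⟨
  n * m / m  ≤⟨ /-monoˡ-≤ m (≤-trans (≤-reflexive (*-comm n m)) m*n≤o) ⟩
  o / m      ∎
  where open ≤-Reasoning

length*≤sum : ∀ {A : Set} (f : A → ℕ) {t} {ys : List A} →
              All (λ y → t ≤ f y) ys → length ys * t ≤ sum (map f ys)
length*≤sum f []       = z≤n
length*≤sum f (p ∷ ps) = +-mono-≤ p (length*≤sum f ps)

sum-map-*ʳ : ∀ {A : Set} (f : A → ℕ) k (ys : List A) →
             sum (map (λ y → f y * k) ys) ≡ sum (map f ys) * k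
sum-map-*ʳ f k []       = refl
sum-map-*ʳ f k (y ∷ ys) = trans (cong (f y * k +_) (sum-map-*ʳ f k ys))
                                (sym (*-distribʳ-+ k (f y) (sum (map f ys))))

AllPairs-weaken : ∀ {A : Set} {P : A → Set} {R S : A → A → Set} {ys : List A} →
                  (∀ {a b} → P a → P b → R a b → S a b) →
                  All P ys → AllPairs R ys → AllPairs S ys
AllPairs-weaken f []       []       = []
AllPairs-weaken f (p ∷ ps) (r ∷ rs) =
  All.zipWith (λ (q , s) → f p q s) (ps , r) ∷ AllPairs-weaken f ps rs

module _ {A : Set} where

  count : List A → (A → Bool) → ℕ
  count xs I = sum (map (λ x → b2n (I x)) xs)

  count-not+count : ∀ xs I → count xs (not ∘ I) + count xs I ≡ length xs
  count-not+count []       I = refl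
  count-not+count (x ∷ xs) I with I x
  ... | true  = trans (+-suc _ _) (cong suc (count-not+count xs I))
  ... | false = cong suc (count-not+count xs I)

  DiffersOn : List A → (A → Bool) → (A → Bool) → Set
  DiffersOn xs I J = Any (λ x → I x ≢ J x) xs

  differsOn-∷⁻ : ∀ {x xs I J b} → I x ≡ b → J x ≡ b → DiffersOn (x ∷ xs) I J → DiffersOn xs I J
  differsOn-∷⁻ Ix≡b Jx≡b (here Ix≢Jx) = ⊥-elim (Ix≢Jx (trans Ix≡b (sym Jx≡b)))
  differsOn-∷⁻ _    _    (there d)    = d

  weightOf : ℕ → List A → (A → Bool) → ℕ
  weightOf w xs I = w ^ count xs (not ∘ I)

  weightedCount : ℕ → List A → List (A → Bool) → ℕ
  weightedCount w xs L = sum (map (weightOf w xs) L)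

  takingValueAt : A → Bool → List (A → Bool) → List (A → Bool)
  takingValueAt x b = filter (λ I → I x Bool.≟ b)

  weightedCount-∷ : ∀ w x xs L →
    weightedCount w (x ∷ xs) L ≡
      weightedCount w xs (takingValueAt x true L) + w * weightedCount w xs (takingValueAt x false L)
  weightedCount-∷ w x xs []      = sym (*-zeroʳ w)
  weightedCount-∷ w x xs (I ∷ L) with I x | weightedCount-∷ w x xs L
  ... | true  | split = trans (cong (weightOf w xs I +_) split) (sym (+-assoc (weightOf w xs I) _ _))
  ... | false | split = begin
      w * v + weightedCount w (x ∷ xs) L  ≡⟨ cong (w * v +_) split ⟩
      w * v + (T + w * F)                 ≡⟨ x∙yz≈y∙xz (w * v) T (w * F) ⟩
      T + (w * v + w * F)                 ≡⟨ cong (T +_) (*-distribˡ-+ w v F) ⟨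
      T + w * (v + F)                     ∎
    where open ≡-Reasoning
          v = weightOf w xs I
          T = weightedCount w xs (takingValueAt x true L)
          F = weightedCount w xs (takingValueAt x false L)

  differsOn-takingValueAt : ∀ x xs b L → AllPairs (DiffersOn (x ∷ xs)) L →
                            AllPairs (DiffersOn xs) (takingValueAt x b L)
  differsOn-takingValueAt x xs b L differ =
    AllPairs-weaken differsOn-∷⁻ (all-filter (λ I → I x Bool.≟ b) L)
                    (AllPairs.filter⁺ (λ I → I x Bool.≟ b) differ)

  weightedCount≤[1+w]^length : ∀ w xs L → AllPairs (DiffersOn xs) L →
                               weightedCount w xs L ≤ (1 + w) ^ length xs
  weightedCount≤[1+w]^length w [] []          _                   = z≤n
  weightedCount≤[1+w]^length w [] (I ∷ [])    _                   = ≤-refl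
  weightedCount≤[1+w]^length w [] (I ∷ J ∷ L) ((() ∷ _) ∷ _)
  weightedCount≤[1+w]^length w (x ∷ xs) L differ = begin
    weightedCount w (x ∷ xs) L
      ≡⟨ weightedCount-∷ w x xs L ⟩
    weightedCount w xs (takingValueAt x true L) + w * weightedCount w xs (takingValueAt x false L)
      ≤⟨ +-mono-≤ (bound true) (*-monoʳ-≤ w (bound false)) ⟩
    (1 + w) ^ length xs + w * (1 + w) ^ length xs
      ∎
    where
    open ≤-Reasoning
    bound : ∀ b → weightedCount w xs (takingValueAt x b L) ≤ (1 + w) ^ length xs
    bound b = weightedCount≤[1+w]^length w xs _ (differsOn-takingValueAt x xs b L differ)

  few-small-sets : ∀ w k .{{_ : NonZero w}} xs L → AllPairs (DiffersOn xs) L →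
                   All (λ I → count xs I ≤ k) L →
                   length L * w ^ length xs ≤ (1 + w) ^ length xs * w ^ k
  few-small-sets w k xs L differ small = begin
    length L * w ^ length xs                 ≤⟨ length*≤sum weight×w^k (All.map heavy small) ⟩
    sum (map weight×w^k L)                   ≡⟨ sum-map-*ʳ (weightOf w xs) (w ^ k) L ⟩
    weightedCount w xs L * w ^ k             ≤⟨ *-monoˡ-≤ (w ^ k) (weightedCount≤[1+w]^length w xs L differ) ⟩
    (1 + w) ^ length xs * w ^ k              ∎
    where
    open ≤-Reasoning
    weight×w^k : (A → Bool) → ℕ
    weight×w^k I = weightOf w xs I * w ^ k
    heavy : ∀ {I} → count xs I ≤ k → w ^ length xs ≤ weight×w^k I
    heavy {I} I≤k = begin
      w ^ length xs                          ≡⟨ cong (w ^_) (count-not+count xs I) ⟨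
      w ^ (count xs (not ∘ I) + count xs I)  ≡⟨ ^-distribˡ-+-* w (count xs (not ∘ I)) (count xs I) ⟩
      weightOf w xs I * w ^ count xs I       ≤⟨ *-monoʳ-≤ (weightOf w xs I) (^-monoʳ-≤ w I≤k) ⟩
      weightOf w xs I * w ^ k                ∎

-- Raising to the m-th power turns w^k into w^(k m) ≤ w^N, leaving n^m ≤ (u^m w / w^m)^N.
power-bound : ∀ {n N k} m w u r s .{{_ : NonZero w}} →
              n * w ^ N ≤ u ^ N * w ^ k → k * m ≤ N → u ^ m * w * r ≤ w ^ m * s →
              n ^ m * r ^ N ≤ s ^ N
power-bound {n} {N} {k} m w u r s counted km≤N constants =
  *-cancelʳ-≤ (n ^ m * r ^ N) (s ^ N) W {{m^n≢0 (w ^ m) N {{m^n≢0 w m}}}} (begin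
    n ^ m * r ^ N * W                ≡⟨ *-assoc (n ^ m) (r ^ N) W ⟩
    n ^ m * (r ^ N * W)              ≡⟨ cong (n ^ m *_) (*-comm (r ^ N) W) ⟩
    n ^ m * (W * r ^ N)              ≡⟨ *-assoc (n ^ m) W (r ^ N) ⟨
    n ^ m * W * r ^ N                ≤⟨ *-monoˡ-≤ (r ^ N) raised ⟩
    (u ^ m) ^ N * w ^ N * r ^ N      ≡⟨ cong (_* r ^ N) (^-distribʳ-* (u ^ m) w N) ⟨
    (u ^ m * w) ^ N * r ^ N          ≡⟨ ^-distribʳ-* (u ^ m * w) r N ⟨
    (u ^ m * w * r) ^ N              ≤⟨ ^-monoˡ-≤ N constants ⟩
    (w ^ m * s) ^ N                  ≡⟨ ^-distribʳ-* (w ^ m) s N ⟩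
    W * s ^ N                        ≡⟨ *-comm W (s ^ N) ⟩
    s ^ N * W                        ∎)
  where
  open ≤-Reasoning
  W = (w ^ m) ^ N
  raised : n ^ m * W ≤ (u ^ m) ^ N * w ^ N
  raised = begin
    n ^ m * W                        ≡⟨ cong (n ^ m *_) ([m^n]^o≡[m^o]^n w N m) ⟨
    n ^ m * (w ^ N) ^ m              ≡⟨ ^-distribʳ-* n (w ^ N) m ⟨
    (n * w ^ N) ^ m                  ≤⟨ ^-monoˡ-≤ m counted ⟩
    (u ^ N * w ^ k) ^ m              ≡⟨ ^-distribʳ-* (u ^ N) (w ^ k) m ⟩
    (u ^ N) ^ m * (w ^ k) ^ m        ≡⟨ cong₂ _*_ ([m^n]^o≡[m^o]^n u N m) (^-*-assoc w k m) ⟩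
    (u ^ m) ^ N * w ^ (k * m)        ≤⟨ *-monoʳ-≤ ((u ^ m) ^ N) (^-monoʳ-≤ w km≤N) ⟩
    (u ^ m) ^ N * w ^ N              ∎

∈-allVertices : ∀ {d} (v : Vertex d) → v ∈ allVertices d
∈-allVertices []          = here refl
∈-allVertices (false ∷ v) = ∈-++⁺ˡ (∈-map⁺ (false ∷_) (∈-allVertices v))
∈-allVertices (true ∷ v)  = ∈-++⁺ʳ _ (∈-map⁺ (true ∷_) (∈-allVertices v))

length-allVertices : ∀ d → length (allVertices d) ≡ 2 ^ d
length-allVertices zero    = refl
length-allVertices (suc d) = begin
  length (map (false ∷_) vs ++ map (true ∷_) vs)        ≡⟨ length-++ (map (false ∷_) vs) ⟩
  length (map (false ∷_) vs) + length (map (true ∷_) vs) ≡⟨ cong₂ _+_ (length-map _ vs) (length-map _ vs) ⟩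
  length vs + length vs                                  ≡⟨ cong₂ _+_ (length-allVertices d) (length-allVertices d) ⟩
  2 ^ d + 2 ^ d                                          ≡⟨ cong (2 ^ d +_) (+-identityʳ (2 ^ d)) ⟨
  2 * 2 ^ d                                              ∎
  where open ≡-Reasoning
        vs = allVertices d

distinct⇒differsOn : ∀ {d} {I J : VSet d} → Distinct I J → DiffersOn (allVertices d) I J
distinct⇒differsOn (v , Iv≢Jv) = lose (∈-allVertices v) Iv≢Jv

-- 17^64 ≈ 2^261.6, so this holds with room to spare.
17^64*16*2^20≤16^64*2^32 : 17 ^ 64 * 16 * 2 ^ 20 ≤ 16 ^ 64 * 2 ^ 32
17^64*16*2^20≤16^64*2^32 = toWitness {a? = 17 ^ 64 * 16 * 2 ^ 20 ≤? 16 ^ 64 * 2 ^ 32} _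

proposition4p1 : ∃[ a ] ∃[ b ] ∃[ p ] ∃[ q ]
    (0 < a × 2 * a < b × 0 < p × 0 < q ×
      ((d : ℕ) (L : List (VSet d)) →
        AllPairs Distinct L →
        All (λ I → Independent I × Balanced I × b * size I ≤ a * 2 ^ d) L →
        length L ^ (2 * q) * 2 ^ (p * 2 ^ d) ≤ 2 ^ (q * 2 ^ d)))
proposition4p1 = 1 , 64 , 20 , 32 , s≤s z≤n , s≤s (s≤s (s≤s z≤n)) , s≤s z≤n , s≤s z≤n , bound
  where
  bound : (d : ℕ) (L : List (VSet d)) → AllPairs Distinct L →
          All (λ I → Independent I × Balanced I × 64 * size I ≤ 1 * 2 ^ d) L →
          length L ^ 64 * 2 ^ (20 * 2 ^ d) ≤ 2 ^ (32 * 2 ^ d)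
  bound d L distinct small =
    subst₂ (λ x y → length L ^ 64 * x ≤ y) (^-*-assoc 2 20 N) (^-*-assoc 2 32 N)
      (power-bound {length L} {N} {N / 64} 64 16 17 (2 ^ 20) (2 ^ 32) counted (m/n*n≤m N 64) 17^64*16*2^20≤16^64*2^32)
    where
    N = 2 ^ d
    count≤N/64 : ∀ {I : VSet d} → Independent I × Balanced I × 64 * size I ≤ 1 * N →
                count (allVertices d) I ≤ N / 64
    count≤N/64 {I} (_ , _ , 64∣I∣≤N) =
      m*n≤o⇒n≤o/m 64 (size I) N (subst (64 * size I ≤_) (*-identityˡ N) 64∣I∣≤N)
    counted : length L * 16 ^ N ≤ 17 ^ N * 16 ^ (N / 64)
    counted = subst (λ n → length L * 16 ^ n ≤ 17 ^ n * 16 ^ (N / 64)) (length-allVertices d)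
      (few-small-sets 16 (N / 64) (allVertices d) L
        (AllPairs.map distinct⇒differsOn distinct)
        (All.map count≤N/64 small))
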